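{- Let $G$ be a connected $\gamma_{tR}$-ER-critical graph. For every $\gamma_{tR}(G)$-function $f$ and every vertex $u$ with $f(u)=0$, we have $\deg(u)=1$. Moreover, $\delta(G)=1$.
   Context: All graphs are finite and simple. A total Roman dominating function (TRD-function) on a graph $G$ with no isolated vertices is a function $f:V(G)\to\{0,1,2\}$ such that every vertex $v$ with $f(v)=0$ is adjacent to some $u$ with $f(u)=2$, and the subgraph induced by $\{w:f(w)>0\}$ has no isolated vertices; its weight is $\sum_v f(v)$, $\gamma_{tR}(G)$ is the minimum weight, and a TRD-function of weight $\gamma_{tR}(G)$ is a $\gamma_{tR}(G)$-function. For an edge $e$ incident with a vertex of degree $1$, define $\gamma_{tR}(G-e)=\infty$. A graph $G$ with no isolated vertices is $\gamma_{tR}$-ER-critical if $\gamma_{tR}(G-e)>\gamma_{tR}(G)$ for every edge $e\in E(G)$. -}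

module Defs where

open import Data.Nat using (ℕ; zero; suc; _+_; _<_; _≤_)
open import Data.Fin using (Fin; toℕ; _≟_)
open import Data.Bool using (Bool; true; false; _∧_; not)
open import Data.Nat.ListAction using (sum)
open import Data.List using (List; map; length; filter; allFin)
open import Data.Product using (Σ; ∃; ∃-syntax; _×_; _,_)
open import Data.Sum using (_⊎_)
open import Relation.Binary.PropositionalEquality using (_≡_)
open import Relation.Nullary.Decidable using (⌊_⌋)

record Graph (n : ℕ) : Set where
  field
    adj   : Fin n → Fin n → Bool
    sym   : ∀ u v → adj u v ≡ adj v u
    irref : ∀ v → adj v v ≡ false
open Graph public

Adj : ∀ {n} → Graph n → Fin n → Fin n → Set
Adj G u v = adj G u v ≡ true

deg : ∀ {n} → Graph n → Fin n → ℕ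
deg {n} G v = length (filter (λ w → adj G v w ≡? true) (allFin n))
  where
    open import Data.Bool.Properties using () renaming (_≟_ to _≡?_)

NoIsolated : ∀ {n} → Graph n → Set
NoIsolated {n} G = ∀ (v : Fin n) → ∃[ w ] Adj G v w

data Reach {n} (G : Graph n) : Fin n → Fin n → Set where
  here : ∀ {v} → Reach G v v
  step : ∀ {u w v} → Adj G u w → Reach G w v → Reach G u v

Connected : ∀ {n} → Graph n → Set
Connected {n} G = (0 < n) × (∀ u v → Reach G u v)

isEdgeEnd : ∀ {n} → Fin n → Fin n → Fin n → Fin n → Bool
isEdgeEnd u v x y = (⌊ x ≟ u ⌋ ∧ ⌊ y ≟ v ⌋) Data.Bool.∨ (⌊ x ≟ v ⌋ ∧ ⌊ y ≟ u ⌋)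
  where import Data.Bool

open import Data.Bool.Properties using (∧-comm; ∨-comm)
open import Relation.Binary.PropositionalEquality using (cong₂; trans; refl)
open import Data.Bool using (_∨_)

private
  isEdgeEnd-sym : ∀ {n} (u v x y : Fin n) → isEdgeEnd u v x y ≡ isEdgeEnd u v y x
  isEdgeEnd-sym u v x y =
    trans (∨-comm (⌊ x ≟ u ⌋ ∧ ⌊ y ≟ v ⌋) (⌊ x ≟ v ⌋ ∧ ⌊ y ≟ u ⌋))
          (cong₂ _∨_ (∧-comm ⌊ x ≟ v ⌋ ⌊ y ≟ u ⌋) (∧-comm ⌊ x ≟ u ⌋ ⌊ y ≟ v ⌋))

  and-false : ∀ b → (b ∧ not true) ≡ false
  and-false false = refl
  and-false true  = refl

deleteEdge : ∀ {n} → Graph n → Fin n → Fin n → Graph n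
deleteEdge G u v = record
  { adj   = λ x y → adj G x y ∧ not (isEdgeEnd u v x y)
  ; sym   = λ x y → cong₂ (λ a b → a ∧ not b) (sym G x y) (isEdgeEnd-sym u v x y)
  ; irref = λ x → helper (adj G x x) (irref G x) (not (isEdgeEnd u v x x))
  }
  where
    helper : ∀ a → a ≡ false → ∀ b → (a ∧ b) ≡ false
    helper .false refl b = refl

Labelling : ℕ → Set
Labelling n = Fin n → Fin 3

val : ∀ {n} → Labelling n → Fin n → ℕ
val f v = toℕ (f v)

weight : ∀ {n} → Labelling n → ℕ
weight {n} f = sum (map (val f) (allFin n))

IsTRD : ∀ {n} → Graph n → Labelling n → Set
IsTRD {n} G f =
  (∀ v → val f v ≡ 0 → ∃[ u ] (Adj G v u × val f u ≡ 2))
  × (∀ v → 0 < val f v → ∃[ w ] (Adj G v w × 0 < val f w))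

IsGammaTRFunction : ∀ {n} → Graph n → Labelling n → Set
IsGammaTRFunction {n} G f = IsTRD G f × (∀ g → IsTRD G g → weight f ≤ weight g)

-- γ_tR-ER-critical: for every edge uv, γ_tR(G - uv) > γ_tR(G), where
-- γ_tR(G - uv) = ∞ if u or v has degree 1 (otherwise G - uv has no isolated
-- vertices and every TRD-function of G - uv weighs more than γ_tR(G)).
ERCritical : ∀ {n} → Graph n → Set
ERCritical {n} G =
  ∀ u v → Adj G u v →
    (deg G u ≡ 1) ⊎ (deg G v ≡ 1)
    ⊎ (∀ g → IsTRD (deleteEdge G u v) g →
         ∀ f → IsGammaTRFunction G f → weight f < weight g)

-- A zero of a γ_tR-function f is dominated by a neighbour v with f(v) = 2; if
-- it had a second neighbour w, deleting uw would leave f a TRD-function, since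
-- u is still dominated by v and u, carrying 0, supports nobody. Criticality
-- then forces deg u = 1 or deg w = 1, and the latter is impossible because w's
-- only neighbour u carries 0. If f has no zero, the same deletion argument on
-- any edge xy shows that x or y is a leaf.
module Submission where

open import Defs
open import Data.Nat using (ℕ; _≤_)
open import Data.Fin using (Fin; toℕ)
open import Data.Product using (_×_; ∃-syntax)
open import Relation.Binary.PropositionalEquality using (_≡_)

open import Data.Nat using (zero; suc; _<_; _<?_; z≤n; s≤s)
open import Data.Nat.Properties using (<-irrefl; ≮⇒≥; <-≤-trans; ≤-refl; n≢0⇒n>0)
import Data.Nat.Properties as ℕ
open import Data.Nat.ListAction using (sum)
import Data.Fin as F
import Data.Fin.Properties as F
open import Data.Bool using (true; false; _∧_)
import Data.Bool.Properties as Bool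
open import Data.List using (List; []; _∷_; filter; length; allFin)
open import Data.List.Properties using (map-cong)
open import Data.List.Membership.Propositional using (_∈_)
open import Data.List.Membership.Propositional.Properties
  using (∈-filter⁺; ∈-filter⁻; ∈-allFin; ∈-length)
open import Data.List.Relation.Unary.Any using (here; there)
open import Data.List.Relation.Unary.All using (_∷_)
open import Data.List.Relation.Unary.AllPairs using (_∷_)
open import Data.List.Relation.Unary.Unique.Propositional using (Unique)
import Data.List.Relation.Unary.Unique.Propositional.Properties as Unique
open import Data.Vec.Functional using (Vector; head; tail) renaming (_∷_ to _◂_)
open import Data.Product using (∃; _,_; proj₁; proj₂)
open import Data.Sum using (_⊎_; inj₁; inj₂; map₂; [_,_]′)
open import Data.Empty using (⊥-elim)
open import Function using (_∘_)
open import Relation.Nullary using (Dec; yes; no; ¬_)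
open import Relation.Nullary.Decidable using (_×-dec_; _→-dec_; ⌊_⌋)
open import Relation.Unary using (Decidable)
open import Relation.Binary.Definitions using (DecidableEquality)
open import Relation.Binary.PropositionalEquality
  using (_≢_; _≗_; refl; trans; cong; subst) renaming (sym to ≡-sym)


module _ {A : Set} where

  length≡1⇒∈-unique : ∀ {xs : List A} {a b} → length xs ≡ 1 → a ∈ xs → b ∈ xs → a ≡ b
  length≡1⇒∈-unique {_ ∷ []} _ (here a≡c) (here b≡c) = trans a≡c (≡-sym b≡c)

  length≡1⊎∃-other : DecidableEquality A → ∀ {xs : List A} {w} → Unique xs → w ∈ xs →
                     length xs ≡ 1 ⊎ ∃[ x ] (x ∈ xs × x ≢ w)
  length≡1⊎∃-other _≟_ {_ ∷ []}    _                 _ = inj₁ refl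
  length≡1⊎∃-other _≟_ {a ∷ b ∷ _} ((a≢b ∷ _) ∷ _) _ with a ≟ _
  ... | no  a≢w = inj₂ (a , here refl , a≢w)
  ... | yes a≡w = inj₂ (b , there (here refl) , λ b≡w → a≢b (trans a≡w (≡-sym b≡w)))


module _ {n : ℕ} (G : Graph n) where

  neighbours : Fin n → List (Fin n)
  neighbours v = filter (λ w → adj G v w Bool.≟ true) (allFin n)

  Adj⇒∈neighbours : ∀ {v w} → Adj G v w → w ∈ neighbours v
  Adj⇒∈neighbours a = ∈-filter⁺ _ (∈-allFin _) a

  Adj⇒≢ : ∀ {v w} → Adj G v w → v ≢ w
  Adj⇒≢ {v} a refl with trans (≡-sym a) (irref G v)
  ... | ()

  Adj-sym : ∀ {v w} → Adj G v w → Adj G w v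
  Adj-sym {v} {w} = trans (Graph.sym G w v)

  Adj⇒1≤deg : ∀ {v w} → Adj G v w → 1 ≤ deg G v
  Adj⇒1≤deg = ∈-length ∘ Adj⇒∈neighbours

  deg≡1⇒neighbour-unique : ∀ {v a b} → deg G v ≡ 1 → Adj G v a → Adj G v b → a ≡ b
  deg≡1⇒neighbour-unique d va vb = length≡1⇒∈-unique d (Adj⇒∈neighbours va) (Adj⇒∈neighbours vb)

  deg≡1⊎another-neighbour : ∀ {v w} → Adj G v w → deg G v ≡ 1 ⊎ ∃[ x ] (Adj G v x × x ≢ w)
  deg≡1⊎another-neighbour {v} vw =
    map₂ (λ (x , x∈ , x≢w) → x , proj₂ (∈-filter⁻ _ {xs = allFin n} x∈) , x≢w)
         (length≡1⊎∃-other F._≟_ (Unique.filter⁺ _ (Unique.allFin⁺ n)) (Adj⇒∈neighbours vw))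


∧-≡false : ∀ {A B : Set} (a? : Dec A) (b? : Dec B) → ¬ (A × B) → ⌊ a? ⌋ ∧ ⌊ b? ⌋ ≡ false
∧-≡false (yes a) (yes b) ¬ab = ⊥-elim (¬ab (a , b))
∧-≡false (yes _) (no _)  _   = refl
∧-≡false (no _)  _       _   = refl

Adj-deleteEdge : ∀ {n} (G : Graph n) {u w x y} → Adj G x y →
                 ¬ (x ≡ u × y ≡ w) → ¬ (x ≡ w × y ≡ u) → Adj (deleteEdge G u w) x y
Adj-deleteEdge G {u} {w} {x} {y} xy p q
  rewrite xy | ∧-≡false (x F.≟ u) (y F.≟ w) p | ∧-≡false (x F.≟ w) (y F.≟ u) q = refl


Supports : ∀ {n} → Labelling n → Fin n → Fin n → Set
Supports f v x = (val f v ≡ 0 → val f x ≡ 2) × (0 < val f v → 0 < val f x)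

Supported : ∀ {n} → Graph n → Labelling n → Fin n → Set
Supported G f v = ∃[ x ] (Adj G v x × Supports f v x)

module _ {n : ℕ} (f : Labelling n) where

  Supports⇒positive : ∀ {v x} → Supports f v x → 0 < val f x
  Supports⇒positive {v} (zero-case , positive-case) with val f v
  ... | zero  rewrite zero-case refl = s≤s z≤n
  ... | suc _ = positive-case (s≤s z≤n)

  Supports⇒≢zero : ∀ {u v x} → val f u ≡ 0 → Supports f v x → x ≢ u
  Supports⇒≢zero fu≡0 s refl = <-irrefl (≡-sym fu≡0) (Supports⇒positive s)

  positive⇒Supports : ∀ {v x} → 0 < val f v → 0 < val f x → Supports f v x
  positive⇒Supports 0<fv 0<fx = (λ fv≡0 → ⊥-elim (<-irrefl (≡-sym fv≡0) 0<fv)) , λ _ → 0<fx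

module _ {n : ℕ} (G : Graph n) (f : Labelling n) where

  IsTRD⇒Supported : IsTRD G f → ∀ v → Supported G f v
  IsTRD⇒Supported (zero-ok , positive-ok) v with val f v in fv
  ... | zero  = let (x , vx , fx≡2) = zero-ok v fv in x , vx , (λ _ → fx≡2) , λ ()
  ... | suc k = let (x , vx , 0<fx) = positive-ok v (subst (0 <_) (≡-sym fv) (s≤s z≤n))
                in x , vx , (λ ()) , λ _ → 0<fx

  Supported⇒IsTRD : (∀ v → Supported G f v) → IsTRD G f
  Supported⇒IsTRD sup =
    (λ v fv≡0 → let (x , vx , s) = sup v in x , vx , proj₁ s fv≡0) ,
    (λ v 0<fv → let (x , vx , s) = sup v in x , vx , proj₂ s 0<fv)

-- Only the endpoints u and w can lose their support.
deleteEdge-IsTRD : ∀ {n} (G : Graph n) f {u w} → IsTRD G f →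
                   ∃[ x ] (Adj G u x × x ≢ w × Supports f u x) →
                   ∃[ x ] (Adj G w x × x ≢ u × Supports f w x) →
                   IsTRD (deleteEdge G u w) f
deleteEdge-IsTRD G f {u} {w} trd (x , ux , x≢w , sx) (y , wy , y≢u , sy) =
  Supported⇒IsTRD (deleteEdge G u w) f (λ z → supported (z F.≟ u) (z F.≟ w))
  where
    supported : ∀ {z} → Dec (z ≡ u) → Dec (z ≡ w) → Supported (deleteEdge G u w) f z
    supported (yes refl) _ =
      x , Adj-deleteEdge G ux (x≢w ∘ proj₂) (λ (_ , x≡u) → Adj⇒≢ G ux (≡-sym x≡u)) , sx
    supported (no _) (yes refl) =
      y , Adj-deleteEdge G wy (λ (_ , y≡w) → Adj⇒≢ G wy (≡-sym y≡w)) (y≢u ∘ proj₂) , sy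
    supported {z} (no z≢u) (no z≢w) =
      let (t , zt , st) = IsTRD⇒Supported G f trd z
      in t , Adj-deleteEdge G zt (z≢u ∘ proj₁) (z≢w ∘ proj₁) , st


module _ {A : Set} (P : A → Set) (μ : A → ℕ)
         (smaller? : ∀ k → Dec (∃[ x ] (P x × μ x < k))) where

  minimum-exists : ∀ {x} → P x → ∃[ m ] (P m × ∀ y → P y → μ m ≤ μ y)
  minimum-exists {x} = descend (suc (μ x)) ≤-refl
    where
      descend : ∀ fuel {x} → μ x < fuel → P x → ∃[ m ] (P m × ∀ y → P y → μ m ≤ μ y)
      descend (suc fuel) {x} (s≤s μx≤fuel) px with smaller? (μ x)
      ... | yes (y , py , μy<μx) = descend fuel (<-≤-trans μy<μx μx≤fuel) py
      ... | no  none             = x , px , λ y py → ≮⇒≥ (λ μy<μx → none (y , py , μy<μx))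

any-vector? : ∀ {k} n {P : Vector (Fin k) n → Set} →
              (∀ {f g} → f ≗ g → P f → P g) → Decidable P → Dec (∃ P)
any-vector? zero P-resp P? with P? (λ ())
... | yes p = yes (_ , p)
... | no ¬p = no λ (f , pf) → ¬p (P-resp (λ ()) pf)
any-vector? (suc n) {P} P-resp P? with any-vector? n Q-resp (λ g → F.any? (λ a → P? (a ◂ g)))
  where
    Q-resp : ∀ {f g} → f ≗ g → ∃[ a ] P (a ◂ f) → ∃[ a ] P (a ◂ g)
    Q-resp f≗g (a , p) = a , P-resp (λ { F.zero → refl ; (F.suc i) → f≗g i }) p
... | yes (g , a , p) = yes (a ◂ g , p)
... | no ¬q = no λ (f , pf) →
  ¬q (tail f , head f , P-resp (λ { F.zero → refl ; (F.suc i) → refl }) pf)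

module _ {n : ℕ} (G : Graph n) where

  IsTRD? : Decidable (IsTRD G)
  IsTRD? f =
    F.all? (λ v → (val f v ℕ.≟ 0) →-dec F.any? (λ u → (adj G v u Bool.≟ true) ×-dec (val f u ℕ.≟ 2)))
    ×-dec
    F.all? (λ v → (0 <? val f v) →-dec F.any? (λ u → (adj G v u Bool.≟ true) ×-dec (0 <? val f u)))

  module _ {f g : Labelling n} (f≗g : f ≗ g) where

    val-resp-≗ : ∀ v → val f v ≡ val g v
    val-resp-≗ v = cong toℕ (f≗g v)

    weight-resp-≗ : weight f ≡ weight g
    weight-resp-≗ = cong sum (map-cong val-resp-≗ (allFin n))

    IsTRD-resp-≗ : IsTRD G f → IsTRD G g
    IsTRD-resp-≗ (zero-ok , positive-ok) =
      (λ v gv≡0 → let (x , vx , fx≡2) = zero-ok v (trans (val-resp-≗ v) gv≡0)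
                  in x , vx , trans (≡-sym (val-resp-≗ x)) fx≡2) ,
      (λ v 0<gv → let (x , vx , 0<fx) = positive-ok v (subst (0 <_) (≡-sym (val-resp-≗ v)) 0<gv)
                  in x , vx , subst (0 <_) (val-resp-≗ x) 0<fx)

  ones-IsTRD : NoIsolated G → IsTRD G (λ _ → F.suc F.zero)
  ones-IsTRD ni = (λ _ ()) , λ v _ → let (w , vw) = ni v in w , vw , s≤s z≤n

  γ-function-exists : NoIsolated G → ∃ (IsGammaTRFunction G)
  γ-function-exists ni = minimum-exists (IsTRD G) weight lighter? (ones-IsTRD ni)
    where
      lighter? : ∀ k → Dec (∃[ g ] (IsTRD G g × weight g < k))
      lighter? k = any-vector? n (λ f≗g (trd , w<k) → IsTRD-resp-≗ f≗g trd , subst (_< k) (weight-resp-≗ f≗g) w<k)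
                                 (λ g → IsTRD? g ×-dec (weight g <? k))


module _ {n : ℕ} (G : Graph n) (critical : ERCritical G) where

  -- The third alternative of criticality fails for f itself.
  deleteEdge-IsTRD⇒leaf : ∀ {u w} f → Adj G u w → IsGammaTRFunction G f →
                          IsTRD (deleteEdge G u w) f → deg G u ≡ 1 ⊎ deg G w ≡ 1
  deleteEdge-IsTRD⇒leaf {u} {w} f uw γf trd with critical u w uw
  ... | inj₁ du≡1           = inj₁ du≡1
  ... | inj₂ (inj₁ dw≡1)    = inj₂ dw≡1
  ... | inj₂ (inj₂ lighter) = ⊥-elim (<-irrefl refl (lighter f trd f γf))

  γ-function-zero⇒deg≡1 : ∀ f → IsGammaTRFunction G f → ∀ u → val f u ≡ 0 → deg G u ≡ 1
  γ-function-zero⇒deg≡1 f γf@(trd , _) u fu≡0 with IsTRD⇒Supported G f trd u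
  ... | v , uv , sv with deg≡1⊎another-neighbour G uv
  ... | inj₁ du≡1 = du≡1
  ... | inj₂ (w , uw , w≢v) with IsTRD⇒Supported G f trd w
  ... | x , wx , sx with deleteEdge-IsTRD⇒leaf f uw γf
          (deleteEdge-IsTRD G f trd (v , uv , w≢v ∘ ≡-sym , sv) (x , wx , Supports⇒≢zero f fu≡0 sx , sx))
  ... | inj₁ du≡1 = du≡1
  ... | inj₂ dw≡1 = ⊥-elim (Supports⇒≢zero f fu≡0 sx (deg≡1⇒neighbour-unique G dw≡1 wx (Adj-sym G uw)))

  ∃deg≡1 : NoIsolated G → Fin n → ∃[ v ] deg G v ≡ 1
  ∃deg≡1 ni x with γ-function-exists G ni
  ... | f , γf@(trd , _) with F.any? (λ z → val f z ℕ.≟ 0)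
  ... | yes (z , fz≡0) = z , γ-function-zero⇒deg≡1 f γf z fz≡0
  ... | no  no-zero with ni x
  ... | y , xy with deg≡1⊎another-neighbour G xy | deg≡1⊎another-neighbour G (Adj-sym G xy)
  ... | inj₁ dx≡1 | _         = x , dx≡1
  ... | inj₂ _    | inj₁ dy≡1 = y , dy≡1
  ... | inj₂ (x′ , xx′ , x′≢y) | inj₂ (y′ , yy′ , y′≢x) =
    [ (x ,_) , (y ,_) ]′ (deleteEdge-IsTRD⇒leaf f xy γf
      (deleteEdge-IsTRD G f trd (x′ , xx′ , x′≢y , positive⇒Supports f (positive x) (positive x′))
                            (y′ , yy′ , y′≢x , positive⇒Supports f (positive y) (positive y′))))
    where
      positive : ∀ v → 0 < val f v
      positive v = n≢0⇒n>0 (λ fv≡0 → no-zero (v , fv≡0))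

proposition7p7 : ∀ {n : ℕ} (G : Graph n) → NoIsolated G → Connected G → ERCritical G →
    (∀ (f : Labelling n) → IsGammaTRFunction G f → ∀ u → val f u ≡ 0 → deg G u ≡ 1)
    × ((∃[ v ] deg G v ≡ 1) × (∀ v → 1 ≤ deg G v))
proposition7p7 G no-isolated (0<n , _) critical =
  γ-function-zero⇒deg≡1 G critical ,
  ∃deg≡1 G critical no-isolated (F.fromℕ< 0<n) ,
  λ v → Adj⇒1≤deg G (proj₂ (no-isolated v))
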